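{- Let $m\ge2$ be an even integer. Suppose there exists an $\mathrm{OA}_I(\ell,r,s,s)_\lambda$ with symbols $0,1,\ldots,s-1$ and $s\ge m+1$. Suppose $A_1,\ldots,A_s,B_1,\ldots,B_s$ are rational numbers such that the $4s$ numbers $\pm A_1,\ldots,\pm A_s,\pm B_1,\ldots,\pm B_s$ are mutually distinct and (1) $[A_1,\ldots,A_s]=^s_m[B_1,\ldots,B_s]$, (2) $\sum_{i=1}^sA_i^{m+2}=\sum_{i=1}^sB_i^{m+2}$, (3) $\sum_{i=1}^sA_i=\sum_{i=1}^sB_i=0$. Let $X$ be the multiset of $2\ell$ vectors $\pm(A_{c_1+1},\ldots,A_{c_r+1})$, where $(c_1,\ldots,c_r)$ ranges over the rows of the Type-I orthogonal array, and let $Y$ be defined in the same way with $B$ in place of $A$. Then $(X,Y)$ is a $\mathrm{PTE}_r$ solution of degree $m+3$ and size $2\ell$.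
   Context: For positive integers with $s\ge t$, an orthogonal array of Type I, $\mathrm{OA}_I(\ell,r,s,t)_\lambda$, is an $\ell\times r$ array with entries from a set of $s$ symbols such that in every $\ell\times t$ subarray each of the $s!/(s-t)!$ ordered $t$-tuples of pairwise distinct symbols occurs as a row exactly $\lambda$ times (and no other rows occur). For multisets $A=\{\mathbf{a}_1,\ldots,\mathbf{a}_n\}$, $B=\{\mathbf{b}_1,\ldots,\mathbf{b}_n\}\subset\mathbb{Q}^r$ with $\mathbf{a}_i=(a_{i1},\ldots,a_{ir})$, $\mathbf{b}_i=(b_{i1},\ldots,b_{ir})$, $[A]=^n_m[B]$ (a $\mathrm{PTE}_r$ solution of degree $m$ and size $n$) means $A,B$ have no common element and $\sum_i\prod_j a_{ij}^{k_j}=\sum_i\prod_j b_{ij}^{k_j}$ for all nonnegative integers $k_j$ with $1\le\sum_jk_j\le m$; for $r=1$ this reads $\sum_i a_i^k=\sum_i b_i^k$ for $1\le k\le m$. -}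

module Defs where

open import Data.Nat as ℕ using (ℕ; zero; suc; _≤_; _<_)
open import Data.Fin as Fin using (Fin; toℕ; splitAt)
open import Data.Fin.Properties using (all?; _≟_)
open import Data.List using (List; length; filter; allFin)
open import Data.Rational as ℚ using (ℚ; 0ℚ; 1ℚ; -_)
open import Data.Sum using (inj₁; inj₂)
open import Data.Product using (_×_)
open import Relation.Binary.PropositionalEquality using (_≡_; _≢_)
open import Relation.Nullary using (¬_)

ℕΣ : ∀ {n} → (Fin n → ℕ) → ℕ
ℕΣ {zero} f = 0
ℕΣ {suc n} f = f Fin.zero ℕ.+ ℕΣ (λ i → f (Fin.suc i))

ℚΣ : ∀ {n} → (Fin n → ℚ) → ℚ
ℚΣ {zero} f = 0ℚ
ℚΣ {suc n} f = f Fin.zero ℚ.+ ℚΣ (λ i → f (Fin.suc i))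

ℚΠ : ∀ {n} → (Fin n → ℚ) → ℚ
ℚΠ {zero} f = 1ℚ
ℚΠ {suc n} f = f Fin.zero ℚ.* ℚΠ (λ i → f (Fin.suc i))

_^_ : ℚ → ℕ → ℚ
q ^ zero = 1ℚ
q ^ suc k = q ℚ.* (q ^ k)

countRows : ∀ {ℓ t s} → (Fin ℓ → Fin t → Fin s) → (Fin t → Fin s) → ℕ
countRows {ℓ} M u = length (filter (λ i → all? (λ j → M i j ≟ u j)) (allFin ℓ))

Injective : ∀ {a b} → (Fin a → Fin b) → Set
Injective f = ∀ i j → f i ≡ f j → i ≡ j

StrictlyIncreasing : ∀ {a b} → (Fin a → Fin b) → Set
StrictlyIncreasing f = ∀ i j → toℕ i < toℕ j → toℕ (f i) < toℕ (f j)

-- An ℓ × t subarray is given by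
-- a strictly increasing choice of t columns.
record IsOAI (ℓ r s t λ' : ℕ) (M : Fin ℓ → Fin r → Fin s) : Set where
  field
    ℓ-pos : 1 ≤ ℓ
    r-pos : 1 ≤ r
    t-pos : 1 ≤ t
    λ-pos : 1 ≤ λ'
    t≤s   : t ≤ s
    t≤r   : t ≤ r
    occurs : (cols : Fin t → Fin r) → StrictlyIncreasing cols →
             (u : Fin t → Fin s) → Injective u →
             countRows (λ i j → M i (cols j)) u ≡ λ'
    onlyDistinct : (cols : Fin t → Fin r) → StrictlyIncreasing cols →
                   (i : Fin ℓ) → Injective (λ j → M i (cols j))

-- PTE_r solution [A] =^n_m [B] for multisets A, B of n vectors in ℚ^r
record IsPTE (r n m : ℕ) (A B : Fin n → Fin r → ℚ) : Set where
  field
    noCommon : ∀ i j → ¬ (∀ k → A i k ≡ B j k)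
    powerSums : (k : Fin r → ℕ) → 1 ≤ ℕΣ k → ℕΣ k ≤ m →
                ℚΣ (λ i → ℚΠ (λ j → A i j ^ k j))
                  ≡ ℚΣ (λ i → ℚΠ (λ j → B i j ^ k j))

plusMinus : ∀ {ℓ r} → (Fin ℓ → Fin r → ℚ) → Fin (ℓ ℕ.+ ℓ) → Fin r → ℚ
plusMinus {ℓ} v i with splitAt ℓ i
... | inj₁ k = v k
... | inj₂ k = λ j → - v k j

-- rows of the OA with symbol c replaced by A_{c+1} (0-indexed: A c)
substRows : ∀ {ℓ r s} → (Fin ℓ → Fin r → Fin s) → (Fin s → ℚ) → Fin ℓ → Fin r → ℚ
substRows M A i j = A (M i j)

signedAB : ∀ {s} → (Fin s → ℚ) → (Fin s → ℚ) → Fin 2 → Fin 2 → Fin s → ℚ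
signedAB A B Fin.zero Fin.zero i = A i
signedAB A B Fin.zero (Fin.suc _) i = - A i
signedAB A B (Fin.suc _) Fin.zero i = B i
signedAB A B (Fin.suc _) (Fin.suc _) i = - B i

MutuallyDistinct : ∀ {s} → (Fin 2 → Fin 2 → Fin s → ℚ) → Set
MutuallyDistinct f = ∀ p σ i q τ j → f p σ i ≡ f q τ j → (p ≡ q) × (σ ≡ τ) × (i ≡ j)

-- Let p_e(A) = Σ_a A_a^e and, for exponents k : Fin n → ℕ, let m̃_k(A) be the sum of
-- Π_j A_{u j}^{k j} over the injective u : Fin n → Fin s. Because t = s ≥ 3, the array has exactly
-- s columns and its rows are the permutations of the symbols, each occurring λ times; so the k-th
-- moment of the rows with A substituted is λ·m̃_k(A), and that of X is (1 + (-1)^|k|)·λ·m̃_k(A).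
-- Splitting off the first index gives m̃_k + Σ_j m̃_{k' + k₀ e_j} = p_{k₀} m̃_{k'} for k = k₀ ∷ k',
-- so m̃_k is a polynomial in the p_e of total weight |k|. For |k| ≤ m + 2 with |k| ≠ m + 1, a term
-- involving p_{m+1} has a cofactor of weight 1, which vanishes because p_1 = 0, and the remaining
-- p_e agree for A and B; hence m̃_k(A) = m̃_k(B). For even m, the weights |k| ≤ m + 3 with
-- 1 + (-1)^|k| ≠ 0 are exactly those ≤ m + 2 other than m + 1.
module Submission where

open import Defs
open import Data.Nat using (ℕ; _≤_; _+_)
open import Data.Nat.Divisibility using (_∣_)
open import Data.Fin using (Fin)
open import Data.Rational using (ℚ; 0ℚ)
open import Relation.Binary.PropositionalEquality using (_≡_)

open import Algebra.Bundles using (CommutativeRing)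
open import Data.Bool using (true; false; if_then_else_)
open import Data.Empty using (⊥-elim)
open import Data.Fin as Fin using (zero; suc; _↑ˡ_; _↑ʳ_)
import Data.Fin.Properties as Finₚ
open import Data.List using (length; filter; tabulate)
import Data.Nat as ℕ
open import Data.Nat.Divisibility using (divides; ∣-refl; ∣m∣n⇒∣m+n)
import Data.Nat.Properties as ℕₚ
open import Data.Product using (_×_; _,_; proj₁; proj₂; ∃; uncurry)
open import Data.Rational as ℚ using (1ℚ; -_; _*_)
import Data.Rational.Properties as ℚₚ
open import Data.Sum using (_⊎_; inj₁; inj₂)
open import Data.Vec.Functional using ([]; _∷_; head; tail; updateAt)
open import Function using (_∘_)
open import Function.Bundles using (_⇔_; mk⇔)
open import Relation.Binary.Core using (_Preserves_⟶_)
open import Relation.Binary.PropositionalEquality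
  using (_≢_; _≗_; refl; sym; trans; cong; cong₂; subst; subst₂; module ≡-Reasoning)
open import Relation.Nullary using (Dec; yes; no; does; ¬_; ¬?)
open import Relation.Nullary.Decidable
  using (dec-true; dec-false; does-⇔; _×-dec_; _→-dec_; _⊎-dec_)
open import Relation.Unary using (Decidable)

open CommutativeRing ℚₚ.+-*-commutativeRing using (semiring; *-commutativeSemigroup)
open import Algebra.Definitions.RawMonoid ℚ.+-0-rawMonoid using () renaming (_×_ to _·_)
open import Algebra.Properties.CommutativeSemigroup *-commutativeSemigroup
  using (interchange; xy∙z≈y∙xz; x∙yz≈y∙xz)
open import Algebra.Properties.Group ℚₚ.+-0-group using () renaming (∙-cancelʳ to +-cancelʳ)
open import Algebra.Properties.Ring ℚₚ.+-*-ring using (-1*x≈-x)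
open import Algebra.Properties.Semiring.Sum semiring
  using ( sum-syntax; sum-cong-≗; sum-replicate-zero; ∑-distrib-+; ∑-comm
        ; *-distribˡ-sum; *-distribʳ-sum)

open ≡-Reasoning

ℚΣ≡∑ : ∀ {n} (f : Fin n → ℚ) → ℚΣ f ≡ ∑[ i < n ] f i
ℚΣ≡∑ {ℕ.zero}  f = refl
ℚΣ≡∑ {ℕ.suc n} f = cong (f zero ℚ.+_) (ℚΣ≡∑ (f ∘ suc))

∑-zero : ∀ {n} {f : Fin n → ℚ} → (∀ i → f i ≡ 0ℚ) → ∑[ i < n ] f i ≡ 0ℚ
∑-zero {n} f≗0 = trans (sum-cong-≗ f≗0) (sum-replicate-zero n)

∑-↑ : ∀ m {n} (f : Fin (m + n) → ℚ) →
      ∑[ i < m + n ] f i ≡ ∑[ i < m ] f (i ↑ˡ n) ℚ.+ ∑[ i < n ] f (m ↑ʳ i)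
∑-↑ ℕ.zero    f = sym (ℚₚ.+-identityˡ _)
∑-↑ (ℕ.suc m) f =
  trans (cong (f zero ℚ.+_) (∑-↑ m (f ∘ suc))) (sym (ℚₚ.+-assoc (f zero) _ _))

-- Defined through does, so that 𝟙 (suc a ≟ suc b) reduces to 𝟙 (a ≟ b).
𝟙 : ∀ {p} {P : Set p} → Dec P → ℚ
𝟙 P? = if does P? then 1ℚ else 0ℚ

𝟙-yes : ∀ {p} {P : Set p} (P? : Dec P) → P → 𝟙 P? ≡ 1ℚ
𝟙-yes P? p = cong (if_then 1ℚ else 0ℚ) (dec-true P? p)

𝟙-no : ∀ {p} {P : Set p} (P? : Dec P) → ¬ P → 𝟙 P? ≡ 0ℚ
𝟙-no P? ¬p = cong (if_then 1ℚ else 0ℚ) (dec-false P? ¬p)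

𝟙-cong : ∀ {p q} {P : Set p} {Q : Set q} → P ⇔ Q → (P? : Dec P) (Q? : Dec Q) → 𝟙 P? ≡ 𝟙 Q?
𝟙-cong P⇔Q P? Q? = cong (if_then 1ℚ else 0ℚ) (does-⇔ P⇔Q P? Q?)

𝟙-× : ∀ {p q} {P : Set p} {Q : Set q} (P? : Dec P) (Q? : Dec Q) →
      𝟙 (P? ×-dec Q?) ≡ 𝟙 P? * 𝟙 Q?
𝟙-× P? Q? with does P?
... | true  = sym (ℚₚ.*-identityˡ (𝟙 Q?))
... | false = sym (ℚₚ.*-zeroˡ (𝟙 Q?))

𝟙-⇔-× : ∀ {p q r} {P : Set p} {Q : Set q} {R : Set r} → P ⇔ (Q × R) →
        (P? : Dec P) (Q? : Dec Q) (R? : Dec R) → 𝟙 P? ≡ 𝟙 Q? * 𝟙 R?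
𝟙-⇔-× P⇔Q×R P? Q? R? = trans (𝟙-cong P⇔Q×R P? (Q? ×-dec R?)) (𝟙-× Q? R?)

𝟙-*-cong : ∀ {p} {P : Set p} (P? : Dec P) {x y : ℚ} → (P → x ≡ y) → 𝟙 P? * x ≡ 𝟙 P? * y
𝟙-*-cong (yes p) x≡y = cong (1ℚ *_) (x≡y p)
𝟙-*-cong (no _)  {x} {y} _ = trans (ℚₚ.*-zeroˡ x) (sym (ℚₚ.*-zeroˡ y))

∑-δ : ∀ {n} (b : Fin n) (h : Fin n → ℚ) → ∑[ a < n ] (𝟙 (b Finₚ.≟ a) * h a) ≡ h b
∑-δ {ℕ.suc n} zero    h = begin
  1ℚ * h zero ℚ.+ ∑[ a < n ] (0ℚ * h (suc a))
    ≡⟨ cong₂ ℚ._+_ (ℚₚ.*-identityˡ (h zero)) (∑-zero (λ a → ℚₚ.*-zeroˡ (h (suc a)))) ⟩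
  h zero ℚ.+ 0ℚ
    ≡⟨ ℚₚ.+-identityʳ (h zero) ⟩
  h zero ∎
∑-δ {ℕ.suc n} (suc b) h = begin
  0ℚ * h zero ℚ.+ ∑[ a < n ] (𝟙 (b Finₚ.≟ a) * h (suc a))
    ≡⟨ cong₂ ℚ._+_ (ℚₚ.*-zeroˡ (h zero)) (∑-δ b (h ∘ suc)) ⟩
  0ℚ ℚ.+ h (suc b)
    ≡⟨ ℚₚ.+-identityˡ (h (suc b)) ⟩
  h (suc b) ∎

^-distribˡ-+-* : ∀ (x : ℚ) a b → x ^ (a + b) ≡ x ^ a * x ^ b
^-distribˡ-+-* x ℕ.zero    b = sym (ℚₚ.*-identityˡ (x ^ b))
^-distribˡ-+-* x (ℕ.suc a) b =
  trans (cong (x *_) (^-distribˡ-+-* x a b)) (sym (ℚₚ.*-assoc x (x ^ a) (x ^ b)))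

neg-^ : ∀ x n → (- x) ^ n ≡ (- 1ℚ) ^ n * x ^ n
neg-^ x ℕ.zero    = refl
neg-^ x (ℕ.suc n) = begin
  (- x) * (- x) ^ n                  ≡⟨ cong₂ _*_ (-1*x≈-x x) (sym (neg-^ x n)) ⟨
  (- 1ℚ * x) * ((- 1ℚ) ^ n * x ^ n)  ≡⟨ interchange (- 1ℚ) x ((- 1ℚ) ^ n) (x ^ n) ⟩
  (- 1ℚ * (- 1ℚ) ^ n) * (x * x ^ n)  ∎

ℚΠ-cong : ∀ {n} {f g : Fin n → ℚ} → f ≗ g → ℚΠ f ≡ ℚΠ g
ℚΠ-cong {ℕ.zero}  f≗g = refl
ℚΠ-cong {ℕ.suc n} f≗g = cong₂ _*_ (f≗g zero) (ℚΠ-cong (f≗g ∘ suc))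

ℚΠ-neg : ∀ {n} (x : Fin n → ℚ) (k : Fin n → ℕ) →
         ℚΠ (λ j → (- x j) ^ k j) ≡ (- 1ℚ) ^ ℕΣ k * ℚΠ (λ j → x j ^ k j)
ℚΠ-neg {ℕ.zero}  x k = refl
ℚΠ-neg {ℕ.suc n} x k = begin
  (- x zero) ^ head k * ℚΠ (λ j → (- x (suc j)) ^ k (suc j))
    ≡⟨ cong₂ _*_ (neg-^ (x zero) (head k)) (ℚΠ-neg (tail x) (tail k)) ⟩
  (σ₀ * x zero ^ head k) * (σ′ * rest)
    ≡⟨ interchange σ₀ (x zero ^ head k) σ′ rest ⟩
  (σ₀ * σ′) * (x zero ^ head k * rest)
    ≡⟨ cong (_* (x zero ^ head k * rest)) (^-distribˡ-+-* (- 1ℚ) (head k) (ℕΣ (tail k))) ⟨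
  (- 1ℚ) ^ ℕΣ k * ℚΠ (λ j → x j ^ k j) ∎
  where
  σ₀ σ′ rest : ℚ
  σ₀ = (- 1ℚ) ^ head k
  σ′ = (- 1ℚ) ^ ℕΣ (tail k)
  rest = ℚΠ (λ j → x (suc j) ^ k (suc j))

ℕΣ-updateAt : ∀ {n} (k : Fin n → ℕ) j c → ℕΣ (updateAt k j (_+ c)) ≡ ℕΣ k + c
ℕΣ-updateAt k zero    c = begin
  head k + c + ℕΣ (tail k)    ≡⟨ ℕₚ.+-assoc (head k) c _ ⟩
  head k + (c + ℕΣ (tail k))  ≡⟨ cong (head k +_) (ℕₚ.+-comm c _) ⟩
  head k + (ℕΣ (tail k) + c)  ≡⟨ ℕₚ.+-assoc (head k) _ c ⟨
  head k + ℕΣ (tail k) + c    ∎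
ℕΣ-updateAt k (suc j) c =
  trans (cong (head k +_) (ℕΣ-updateAt (tail k) j c)) (sym (ℕₚ.+-assoc (head k) _ c))

m+n≡1⇒m≡1∨n≡1 : ∀ m {n} → m + n ≡ 1 → m ≡ 1 ⊎ n ≡ 1
m+n≡1⇒m≡1∨n≡1 ℕ.zero             m+n≡1 = inj₂ m+n≡1
m+n≡1⇒m≡1∨n≡1 (ℕ.suc ℕ.zero)     _     = inj₁ refl
m+n≡1⇒m≡1∨n≡1 (ℕ.suc (ℕ.suc m)) ()

summand≢ : ∀ d {a b} → a + b ≤ d + 2 → a + b ≢ d + 1 → b ≢ 1 → a ≢ d + 1
summand≢ d {b = b} a+b≤d+2 a+b≢d+1 b≢1 refl =
  a+b≢d+1 (trans (cong (d + 1 +_) b≡0) (ℕₚ.+-identityʳ (d + 1)))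
  where
  b≤1 : b ≤ 1
  b≤1 = ℕₚ.+-cancelˡ-≤ (d + 1) b 1 (subst (d + 1 + b ≤_) (sym (ℕₚ.+-assoc d 1 1)) a+b≤d+2)
  b≡0 : b ≡ 0
  b≡0 = ℕₚ.n<1⇒n≡0 (ℕₚ.≤∧≢⇒< b≤1 b≢1)

sumTuples : ∀ {s} n → ((Fin n → Fin s) → ℚ) → ℚ
sumTuples     ℕ.zero    g = g []
sumTuples {s} (ℕ.suc n) g = sumTuples n (λ v → ∑[ a < s ] g (a ∷ v))

module _ {s : ℕ} where

  sumTuples-cong : ∀ n {g h : (Fin n → Fin s) → ℚ} → (∀ u → g u ≡ h u) →
                   sumTuples n g ≡ sumTuples n h
  sumTuples-cong ℕ.zero    g≗h = g≗h []
  sumTuples-cong (ℕ.suc n) g≗h = sumTuples-cong n (λ v → sum-cong-≗ (λ a → g≗h (a ∷ v)))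

  sumTuples-distrib-+ : ∀ n (g h : (Fin n → Fin s) → ℚ) →
                        sumTuples n (λ u → g u ℚ.+ h u) ≡ sumTuples n g ℚ.+ sumTuples n h
  sumTuples-distrib-+ ℕ.zero    g h = refl
  sumTuples-distrib-+ (ℕ.suc n) g h = trans
    (sumTuples-cong n (λ v → ∑-distrib-+ (λ a → g (a ∷ v)) (λ a → h (a ∷ v))))
    (sumTuples-distrib-+ n _ _)

  *-distribˡ-sumTuples : ∀ n c (g : (Fin n → Fin s) → ℚ) →
                         c * sumTuples n g ≡ sumTuples n (λ u → c * g u)
  *-distribˡ-sumTuples ℕ.zero    c g = refl
  *-distribˡ-sumTuples (ℕ.suc n) c g = trans
    (*-distribˡ-sumTuples n c _)
    (sumTuples-cong n (λ v → *-distribˡ-sum c (λ a → g (a ∷ v))))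

  sumTuples-comm : ∀ n {k} (h : Fin k → (Fin n → Fin s) → ℚ) →
                   sumTuples n (λ u → ∑[ j < k ] h j u) ≡ ∑[ j < k ] sumTuples n (h j)
  sumTuples-comm ℕ.zero    h = refl
  sumTuples-comm (ℕ.suc n) h = trans
    (sumTuples-cong n (λ v → ∑-comm (λ a j → h j (a ∷ v))))
    (sumTuples-comm n (λ j v → ∑[ a < s ] h j (a ∷ v)))

  _≗?_ : ∀ {n} (u v : Fin n → Fin s) → Dec (u ≗ v)
  u ≗? v = Finₚ.all? (λ j → u j Finₚ.≟ v j)

  ≗-∷ : ∀ {n} (v : Fin (ℕ.suc n) → Fin s) a w → v ≗ (a ∷ w) ⇔ (head v ≡ a × tail v ≗ w)
  ≗-∷ v a w = mk⇔ (λ v≗a∷w → v≗a∷w zero , v≗a∷w ∘ suc)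
                  (λ { (v₀≡a , _) zero → v₀≡a ; (_ , tail≗w) (suc j) → tail≗w j })

  sumTuples-δ : ∀ n {G : (Fin n → Fin s) → ℚ} → G Preserves _≗_ ⟶ _≡_ →
                ∀ v → sumTuples n (λ u → 𝟙 (v ≗? u) * G u) ≡ G v
  sumTuples-δ ℕ.zero    {G} G-resp v =
    trans (cong₂ _*_ (𝟙-yes (v ≗? []) (λ ())) (G-resp (λ ()))) (ℚₚ.*-identityˡ (G v))
  sumTuples-δ (ℕ.suc n) {G} G-resp v = begin
    sumTuples n (λ w → ∑[ a < s ] (𝟙 (v ≗? (a ∷ w)) * G (a ∷ w)))
      ≡⟨ sumTuples-cong n first-coordinate ⟩
    sumTuples n (λ w → 𝟙 (tail v ≗? w) * G (head v ∷ w))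
      ≡⟨ sumTuples-δ n (G-resp ∘ ∷-cong) (tail v) ⟩
    G (head v ∷ tail v)
      ≡⟨ G-resp head∷tail ⟩
    G v ∎
    where
    ∷-cong : ∀ {w w′} → w ≗ w′ → (head v ∷ w) ≗ (head v ∷ w′)
    ∷-cong w≗w′ zero    = refl
    ∷-cong w≗w′ (suc j) = w≗w′ j
    head∷tail : (head v ∷ tail v) ≗ v
    head∷tail zero    = refl
    head∷tail (suc j) = refl
    first-coordinate : ∀ w → ∑[ a < s ] (𝟙 (v ≗? (a ∷ w)) * G (a ∷ w))
                               ≡ 𝟙 (tail v ≗? w) * G (head v ∷ w)
    first-coordinate w = begin
      ∑[ a < s ] (𝟙 (v ≗? (a ∷ w)) * G (a ∷ w))
        ≡⟨ sum-cong-≗ (λ a → trans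
             (cong (_* G (a ∷ w))
                   (𝟙-⇔-× (≗-∷ v a w) (v ≗? (a ∷ w)) (head v Finₚ.≟ a) (tail v ≗? w)))
             (ℚₚ.*-assoc (𝟙 (head v Finₚ.≟ a)) (𝟙 (tail v ≗? w)) (G (a ∷ w)))) ⟩
      ∑[ a < s ] (𝟙 (head v Finₚ.≟ a) * (𝟙 (tail v ≗? w) * G (a ∷ w)))
        ≡⟨ ∑-δ (head v) (λ a → 𝟙 (tail v ≗? w) * G (a ∷ w)) ⟩
      𝟙 (tail v ≗? w) * G (head v ∷ w) ∎

  Fresh : ∀ {n} → Fin s → (Fin n → Fin s) → Set
  Fresh a v = ∀ j → v j ≢ a

  fresh? : ∀ {n} (a : Fin s) (v : Fin n → Fin s) → Dec (Fresh a v)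
  fresh? a v = Finₚ.all? (λ j → ¬? (v j Finₚ.≟ a))

  injective? : ∀ {n} (u : Fin n → Fin s) → Dec (Injective u)
  injective? u = Finₚ.all? (λ i → Finₚ.all? (λ j → (u i Finₚ.≟ u j) →-dec (i Finₚ.≟ j)))

  injective-∷ : ∀ {n} a (v : Fin n → Fin s) → Injective (a ∷ v) ⇔ (Fresh a v × Injective v)
  injective-∷ a v = mk⇔
    (λ inj → (λ j vj≡a → 0≢suc (inj zero (suc j) (sym vj≡a)))
           , (λ i j vi≡vj → Finₚ.suc-injective (inj (suc i) (suc j) vi≡vj)))
    (λ { (fresh , inj) zero    zero    _     → refl
       ; (fresh , inj) zero    (suc j) a≡vj  → ⊥-elim (fresh j (sym a≡vj))
       ; (fresh , inj) (suc i) zero    vi≡a  → ⊥-elim (fresh i vi≡a)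
       ; (fresh , inj) (suc i) (suc j) vi≡vj → cong suc (inj i j vi≡vj) })
    where
    0≢suc : ∀ {n} {j : Fin n} → zero ≢ suc j
    0≢suc ()

  fresh-or-hit : ∀ {n} {v : Fin n → Fin s} → Injective v →
                 ∀ a → 𝟙 (fresh? a v) ℚ.+ ∑[ j < n ] 𝟙 (v j Finₚ.≟ a) ≡ 1ℚ
  fresh-or-hit {n} {v} inj a with Finₚ.any? (λ j → v j Finₚ.≟ a)
  ... | yes (j₀ , vj₀≡a) = cong₂ ℚ._+_ (𝟙-no (fresh? a v) (λ fresh → fresh j₀ vj₀≡a)) (begin
    ∑[ j < n ] 𝟙 (v j Finₚ.≟ a)
      ≡⟨ sum-cong-≗ (λ j → trans (𝟙-cong hit⇔ (v j Finₚ.≟ a) (j₀ Finₚ.≟ j))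
                                 (sym (ℚₚ.*-identityʳ _))) ⟩
    ∑[ j < n ] (𝟙 (j₀ Finₚ.≟ j) * 1ℚ)
      ≡⟨ ∑-δ j₀ (λ _ → 1ℚ) ⟩
    1ℚ ∎)
    where
    hit⇔ : ∀ {j} → v j ≡ a ⇔ j₀ ≡ j
    hit⇔ {j} = mk⇔ (λ vj≡a → inj j₀ j (trans vj₀≡a (sym vj≡a))) (λ { refl → vj₀≡a })
  ... | no no-hit = cong₂ ℚ._+_ (𝟙-yes (fresh? a v) (λ j vj≡a → no-hit (j , vj≡a)))
                                (∑-zero (λ j → 𝟙-no (v j Finₚ.≟ a) (λ vj≡a → no-hit (j , vj≡a))))

  ∑-fresh : ∀ {n} {v : Fin n → Fin s} → Injective v → (h : Fin s → ℚ) →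
            ∑[ a < s ] (𝟙 (fresh? a v) * h a) ℚ.+ ∑[ j < n ] h (v j) ≡ ∑[ a < s ] h a
  ∑-fresh {n} {v} inj h = begin
    F ℚ.+ ∑[ j < n ] h (v j)
      ≡⟨ cong (F ℚ.+_) (sum-cong-≗ (λ j → sym (∑-δ (v j) h))) ⟩
    F ℚ.+ ∑[ j < n ] ∑[ a < s ] (𝟙 (v j Finₚ.≟ a) * h a)
      ≡⟨ cong (F ℚ.+_) (∑-comm (λ j a → 𝟙 (v j Finₚ.≟ a) * h a)) ⟩
    F ℚ.+ ∑[ a < s ] ∑[ j < n ] (𝟙 (v j Finₚ.≟ a) * h a)
      ≡⟨ ∑-distrib-+ (λ a → 𝟙 (fresh? a v) * h a)
                     (λ a → ∑[ j < n ] (𝟙 (v j Finₚ.≟ a) * h a)) ⟨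
    ∑[ a < s ] (𝟙 (fresh? a v) * h a ℚ.+ ∑[ j < n ] (𝟙 (v j Finₚ.≟ a) * h a))
      ≡⟨ sum-cong-≗ counted-once ⟩
    ∑[ a < s ] h a ∎
    where
    F : ℚ
    F = ∑[ a < s ] (𝟙 (fresh? a v) * h a)
    counted-once : ∀ a → 𝟙 (fresh? a v) * h a ℚ.+ ∑[ j < n ] (𝟙 (v j Finₚ.≟ a) * h a) ≡ h a
    counted-once a = begin
      𝟙 (fresh? a v) * h a ℚ.+ ∑[ j < n ] (𝟙 (v j Finₚ.≟ a) * h a)
        ≡⟨ cong (𝟙 (fresh? a v) * h a ℚ.+_) (*-distribʳ-sum (h a) (λ j → 𝟙 (v j Finₚ.≟ a))) ⟨
      𝟙 (fresh? a v) * h a ℚ.+ ∑[ j < n ] 𝟙 (v j Finₚ.≟ a) * h a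
        ≡⟨ ℚₚ.*-distribʳ-+ (h a) (𝟙 (fresh? a v)) (∑[ j < n ] 𝟙 (v j Finₚ.≟ a)) ⟨
      (𝟙 (fresh? a v) ℚ.+ ∑[ j < n ] 𝟙 (v j Finₚ.≟ a)) * h a
        ≡⟨ cong (_* h a) (fresh-or-hit inj a) ⟩
      1ℚ * h a
        ≡⟨ ℚₚ.*-identityˡ (h a) ⟩
      h a ∎

  ∑-∷-injective : ∀ {n} (v : Fin n → Fin s) (h : Fin s → ℚ) →
    ∑[ a < s ] (𝟙 (injective? (a ∷ v)) * h a) ℚ.+ ∑[ j < n ] (𝟙 (injective? v) * h (v j))
      ≡ 𝟙 (injective? v) * ∑[ a < s ] h a
  ∑-∷-injective {n} v h = begin
    ∑[ a < s ] (𝟙 (injective? (a ∷ v)) * h a) ℚ.+ ∑[ j < n ] (ι * h (v j))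
      ≡⟨ cong (ℚ._+ ∑[ j < n ] (ι * h (v j))) (sum-cong-≗ split-fresh) ⟩
    ∑[ a < s ] (ι * (𝟙 (fresh? a v) * h a)) ℚ.+ ∑[ j < n ] (ι * h (v j))
      ≡⟨ cong₂ ℚ._+_ (*-distribˡ-sum ι (λ a → 𝟙 (fresh? a v) * h a)) (*-distribˡ-sum ι (h ∘ v)) ⟨
    ι * ∑[ a < s ] (𝟙 (fresh? a v) * h a) ℚ.+ ι * ∑[ j < n ] h (v j)
      ≡⟨ ℚₚ.*-distribˡ-+ ι (∑[ a < s ] (𝟙 (fresh? a v) * h a)) (∑[ j < n ] h (v j)) ⟨
    ι * (∑[ a < s ] (𝟙 (fresh? a v) * h a) ℚ.+ ∑[ j < n ] h (v j))
      ≡⟨ 𝟙-*-cong (injective? v) (λ inj → ∑-fresh inj h) ⟩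
    ι * ∑[ a < s ] h a ∎
    where
    ι : ℚ
    ι = 𝟙 (injective? v)
    split-fresh : ∀ a → 𝟙 (injective? (a ∷ v)) * h a ≡ ι * (𝟙 (fresh? a v) * h a)
    split-fresh a = trans
      (cong (_* h a) (𝟙-⇔-× (injective-∷ a v) (injective? (a ∷ v)) (fresh? a v) (injective? v)))
      (xy∙z≈y∙xz (𝟙 (fresh? a v)) ι (h a))

module PowerSums {s : ℕ} (A : Fin s → ℚ) where

  powerSum : ℕ → ℚ
  powerSum e = ∑[ a < s ] A a ^ e

  monomial : ∀ {n} → (Fin n → ℕ) → (Fin n → Fin s) → ℚ
  monomial k u = ℚΠ (λ j → A (u j) ^ k j)

  monomial-≗ : ∀ {n} (k : Fin n → ℕ) → monomial k Preserves _≗_ ⟶ _≡_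
  monomial-≗ k u≗v = ℚΠ-cong (λ j → cong (λ a → A a ^ k j) (u≗v j))

  monomial-updateAt : ∀ {n} (k : Fin n → ℕ) j c v →
                      monomial (updateAt k j (_+ c)) v ≡ A (v j) ^ c * monomial k v
  monomial-updateAt k zero    c v = begin
    x ^ (head k + c) * rest    ≡⟨ cong (_* rest) (^-distribˡ-+-* x (head k) c) ⟩
    x ^ head k * x ^ c * rest  ≡⟨ xy∙z≈y∙xz (x ^ head k) (x ^ c) rest ⟩
    x ^ c * (x ^ head k * rest) ∎
    where
    x rest : ℚ
    x = A (v zero)
    rest = monomial (tail k) (tail v)
  monomial-updateAt k (suc j) c v = trans
    (cong (A (v zero) ^ head k *_) (monomial-updateAt (tail k) j c (tail v)))
    (x∙yz≈y∙xz (A (v zero) ^ head k) (A (v (suc j)) ^ c) (monomial (tail k) (tail v)))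

  augmentedMonomial : ∀ {n} → (Fin n → ℕ) → ℚ
  augmentedMonomial {n} k = sumTuples n (λ u → 𝟙 (injective? u) * monomial k u)

  -- The first index of an injective tuple is a symbol not used by the rest v; summing over all
  -- symbols instead also counts the values v j, which merge into the exponent at position j.
  augmentedMonomial-rec : ∀ {n} (k : Fin (ℕ.suc n) → ℕ) →
    augmentedMonomial k ℚ.+ ∑[ j < n ] augmentedMonomial (updateAt (tail k) j (_+ head k))
      ≡ powerSum (head k) * augmentedMonomial (tail k)
  augmentedMonomial-rec {n} k = begin
    sumTuples n new ℚ.+ ∑[ j < n ] sumTuples n (merged j)
      ≡⟨ cong (sumTuples n new ℚ.+_) (sumTuples-comm n merged) ⟨
    sumTuples n new ℚ.+ sumTuples n (λ v → ∑[ j < n ] merged j v)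
      ≡⟨ sumTuples-distrib-+ n new (λ v → ∑[ j < n ] merged j v) ⟨
    sumTuples n (λ v → new v ℚ.+ ∑[ j < n ] merged j v)
      ≡⟨ sumTuples-cong n extend ⟩
    sumTuples n (λ v → powerSum c * (𝟙 (injective? v) * monomial (tail k) v))
      ≡⟨ *-distribˡ-sumTuples n (powerSum c) _ ⟨
    powerSum c * augmentedMonomial (tail k) ∎
    where
    c : ℕ
    c = head k
    new : (Fin n → Fin s) → ℚ
    new v = ∑[ a < s ] (𝟙 (injective? (a ∷ v)) * monomial k (a ∷ v))
    merged : Fin n → (Fin n → Fin s) → ℚ
    merged j v = 𝟙 (injective? v) * monomial (updateAt (tail k) j (_+ c)) v
    extend : ∀ v → new v ℚ.+ ∑[ j < n ] merged j v
                     ≡ powerSum c * (𝟙 (injective? v) * monomial (tail k) v)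
    extend v = begin
      new v ℚ.+ ∑[ j < n ] merged j v
        ≡⟨ cong (new v ℚ.+_) (sum-cong-≗ (λ j → cong (ι *_) (monomial-updateAt (tail k) j c v))) ⟩
      new v ℚ.+ ∑[ j < n ] (ι * (A (v j) ^ c * μ))
        ≡⟨ ∑-∷-injective v (λ a → A a ^ c * μ) ⟩
      ι * ∑[ a < s ] (A a ^ c * μ)
        ≡⟨ cong (ι *_) (*-distribʳ-sum μ (λ a → A a ^ c)) ⟨
      ι * (powerSum c * μ)
        ≡⟨ x∙yz≈y∙xz ι (powerSum c) μ ⟩
      powerSum c * (ι * μ) ∎
      where
      ι μ : ℚ
      ι = 𝟙 (injective? v)
      μ = monomial (tail k) v

  mutual
    augmentedMonomial-weight-one : powerSum 1 ≡ 0ℚ → ∀ {n} (k : Fin n → ℕ) → ℕΣ k ≡ 1 →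
                                   augmentedMonomial k ≡ 0ℚ
    augmentedMonomial-weight-one p₁≡0 {ℕ.zero}  k ()
    augmentedMonomial-weight-one p₁≡0 {ℕ.suc n} k ∣k∣≡1 = begin
      augmentedMonomial k
        ≡⟨ ℚₚ.+-identityʳ (augmentedMonomial k) ⟨
      augmentedMonomial k ℚ.+ 0ℚ
        ≡⟨ cong (augmentedMonomial k ℚ.+_) (∑-zero merged≡0) ⟨
      augmentedMonomial k ℚ.+ ∑[ j < n ] augmentedMonomial (merged j)
        ≡⟨ augmentedMonomial-rec k ⟩
      powerSum (head k) * augmentedMonomial (tail k)
        ≡⟨ degenerate-term≡0 p₁≡0 (head k) (tail k) (m+n≡1⇒m≡1∨n≡1 (head k) ∣k∣≡1) ⟩
      0ℚ ∎
      where
      merged : Fin n → Fin n → ℕ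
      merged j = updateAt (tail k) j (_+ head k)
      merged≡0 : ∀ j → augmentedMonomial (merged j) ≡ 0ℚ
      merged≡0 j = augmentedMonomial-weight-one p₁≡0 (merged j)
        (trans (ℕΣ-updateAt (tail k) j (head k)) (trans (ℕₚ.+-comm _ (head k)) ∣k∣≡1))

    degenerate-term≡0 : powerSum 1 ≡ 0ℚ → ∀ c {n} (k : Fin n → ℕ) → c ≡ 1 ⊎ ℕΣ k ≡ 1 →
                        powerSum c * augmentedMonomial k ≡ 0ℚ
    degenerate-term≡0 p₁≡0 c k (inj₁ refl)  =
      trans (cong (_* augmentedMonomial k) p₁≡0) (ℚₚ.*-zeroˡ (augmentedMonomial k))
    degenerate-term≡0 p₁≡0 c k (inj₂ ∣k∣≡1) = trans
      (cong (powerSum c *_) (augmentedMonomial-weight-one p₁≡0 k ∣k∣≡1)) (ℚₚ.*-zeroʳ (powerSum c))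

open PowerSums

module _ {s : ℕ} (A B : Fin s → ℚ) (d : ℕ)
  (agree : ∀ e → e ≤ d + 2 → e ≢ d + 1 → powerSum A e ≡ powerSum B e)
  (A₁≡0 : powerSum A 1 ≡ 0ℚ) (B₁≡0 : powerSum B 1 ≡ 0ℚ) where

  augmentedMonomial-agree : ∀ {n} (k : Fin n → ℕ) → ℕΣ k ≤ d + 2 → ℕΣ k ≢ d + 1 →
                            augmentedMonomial A k ≡ augmentedMonomial B k
  augmentedMonomial-agree {ℕ.zero}  k _ _ = refl
  augmentedMonomial-agree {ℕ.suc n} k ∣k∣≤d+2 ∣k∣≢d+1 =
    +-cancelʳ (∑[ j < n ] augmentedMonomial A (merged j)) _ _ (begin
      augmentedMonomial A k ℚ.+ ∑[ j < n ] augmentedMonomial A (merged j)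
        ≡⟨ augmentedMonomial-rec A k ⟩
      powerSum A c * augmentedMonomial A (tail k)
        ≡⟨ head-term ⟩
      powerSum B c * augmentedMonomial B (tail k)
        ≡⟨ augmentedMonomial-rec B k ⟨
      augmentedMonomial B k ℚ.+ ∑[ j < n ] augmentedMonomial B (merged j)
        ≡⟨ cong (augmentedMonomial B k ℚ.+_) (sum-cong-≗ merged-agree) ⟨
      augmentedMonomial B k ℚ.+ ∑[ j < n ] augmentedMonomial A (merged j) ∎)
    where
    c : ℕ
    c = head k
    merged : Fin n → Fin n → ℕ
    merged j = updateAt (tail k) j (_+ c)
    ∣merged∣ : ∀ j → ℕΣ (merged j) ≡ ℕΣ k
    ∣merged∣ j = trans (ℕΣ-updateAt (tail k) j c) (ℕₚ.+-comm _ c)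
    merged-agree : ∀ j → augmentedMonomial A (merged j) ≡ augmentedMonomial B (merged j)
    merged-agree j = augmentedMonomial-agree (merged j)
      (subst (_≤ d + 2) (sym (∣merged∣ j)) ∣k∣≤d+2) (∣k∣≢d+1 ∘ trans (sym (∣merged∣ j)))
    head-term : powerSum A c * augmentedMonomial A (tail k)
              ≡ powerSum B c * augmentedMonomial B (tail k)
    head-term with (c ℕₚ.≟ 1) ⊎-dec (ℕΣ (tail k) ℕₚ.≟ 1)
    ... | yes degenerate = trans (degenerate-term≡0 A A₁≡0 c (tail k) degenerate)
                                 (sym (degenerate-term≡0 B B₁≡0 c (tail k) degenerate))
    ... | no ¬degenerate = cong₂ _*_
      (agree c (ℕₚ.≤-trans (ℕₚ.m≤m+n c _) ∣k∣≤d+2)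
               (summand≢ d ∣k∣≤d+2 ∣k∣≢d+1 (¬degenerate ∘ inj₂)))
      (augmentedMonomial-agree (tail k) (ℕₚ.≤-trans (ℕₚ.m≤n+m _ c) ∣k∣≤d+2)
        (summand≢ d (subst (_≤ d + 2) (ℕₚ.+-comm c _) ∣k∣≤d+2)
                    (∣k∣≢d+1 ∘ trans (ℕₚ.+-comm c _)) (¬degenerate ∘ inj₁)))

length-filter : ∀ {a p} {X : Set a} {P : X → Set p} (P? : Decidable P) {n} (f : Fin n → X) →
                length (filter P? (tabulate f)) · 1ℚ ≡ ∑[ i < n ] 𝟙 (P? (f i))
length-filter P? {ℕ.zero}  f = refl
length-filter P? {ℕ.suc n} f with P? (f zero)
... | yes _ = cong (1ℚ ℚ.+_) (length-filter P? (f ∘ suc))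
... | no  _ = trans (length-filter P? (f ∘ suc)) (sym (ℚₚ.+-identityˡ _))

∑-rows : ∀ {ℓ n s} (M : Fin ℓ → Fin n → Fin s) {G : (Fin n → Fin s) → ℚ} →
         G Preserves _≗_ ⟶ _≡_ →
         ∑[ i < ℓ ] G (M i) ≡ sumTuples n (λ u → ∑[ i < ℓ ] 𝟙 (M i ≗? u) * G u)
∑-rows {ℓ} {n} M {G} G-resp = begin
  ∑[ i < ℓ ] G (M i)
    ≡⟨ sum-cong-≗ (λ i → sumTuples-δ n G-resp (M i)) ⟨
  ∑[ i < ℓ ] sumTuples n (λ u → 𝟙 (M i ≗? u) * G u)
    ≡⟨ sumTuples-comm n (λ i u → 𝟙 (M i ≗? u) * G u) ⟨
  sumTuples n (λ u → ∑[ i < ℓ ] (𝟙 (M i ≗? u) * G u))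
    ≡⟨ sumTuples-cong n (λ u → *-distribʳ-sum (G u) (λ i → 𝟙 (M i ≗? u))) ⟨
  sumTuples n (λ u → ∑[ i < ℓ ] 𝟙 (M i ≗? u) * G u) ∎

module _ {ℓ s λ'} {M : Fin ℓ → Fin s → Fin s} (oa : IsOAI ℓ s s s λ' M) where

  row-multiplicity : ∀ u → ∑[ i < ℓ ] 𝟙 (M i ≗? u) ≡ λ' · 1ℚ * 𝟙 (injective? u)
  row-multiplicity u with injective? u
  ... | yes inj = begin
    ∑[ i < ℓ ] 𝟙 (M i ≗? u)     ≡⟨ length-filter (λ i → M i ≗? u) (λ i → i) ⟨
    countRows M u · 1ℚ           ≡⟨ cong (_· 1ℚ) (IsOAI.occurs oa (λ j → j) (λ _ _ i<j → i<j) u inj) ⟩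
    λ' · 1ℚ                      ≡⟨ ℚₚ.*-identityʳ (λ' · 1ℚ) ⟨
    λ' · 1ℚ * 1ℚ                 ≡⟨ cong (λ' · 1ℚ *_) (𝟙-yes (injective? u) inj) ⟨
    λ' · 1ℚ * 𝟙 (injective? u)   ∎
  ... | no ¬inj = begin
    ∑[ i < ℓ ] 𝟙 (M i ≗? u)     ≡⟨ ∑-zero (λ i → 𝟙-no (M i ≗? u) (¬inj ∘ row-injective i)) ⟩
    0ℚ                           ≡⟨ ℚₚ.*-zeroʳ (λ' · 1ℚ) ⟨
    λ' · 1ℚ * 0ℚ                 ≡⟨ cong (λ' · 1ℚ *_) (𝟙-no (injective? u) ¬inj) ⟨
    λ' · 1ℚ * 𝟙 (injective? u)   ∎
    where
    row-injective : ∀ i → M i ≗ u → Injective u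
    row-injective i Mi≗u a b ua≡ub = IsOAI.onlyDistinct oa (λ j → j) (λ _ _ i<j → i<j) i a b
      (trans (Mi≗u a) (trans ua≡ub (sym (Mi≗u b))))

moment : ∀ {N r} → (Fin N → Fin r → ℚ) → (Fin r → ℕ) → ℚ
moment {N} X k = ∑[ i < N ] ℚΠ (λ j → X i j ^ k j)

moment-substRows : ∀ {ℓ s λ'} {M : Fin ℓ → Fin s → Fin s} → IsOAI ℓ s s s λ' M →
                   ∀ A k → moment (substRows M A) k ≡ λ' · 1ℚ * augmentedMonomial A k
moment-substRows {ℓ} {s} {λ'} {M} oa A k = begin
  ∑[ i < ℓ ] monomial A k (M i)
    ≡⟨ ∑-rows M (monomial-≗ A k) ⟩
  sumTuples s (λ u → ∑[ i < ℓ ] 𝟙 (M i ≗? u) * monomial A k u)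
    ≡⟨ sumTuples-cong s (λ u → trans (cong (_* monomial A k u) (row-multiplicity oa u))
                                     (ℚₚ.*-assoc (λ' · 1ℚ) _ (monomial A k u))) ⟩
  sumTuples s (λ u → λ' · 1ℚ * (𝟙 (injective? u) * monomial A k u))
    ≡⟨ *-distribˡ-sumTuples s (λ' · 1ℚ) _ ⟨
  λ' · 1ℚ * augmentedMonomial A k ∎

moment-substRows-agree : ∀ {ℓ s λ'} {M : Fin ℓ → Fin s → Fin s} → IsOAI ℓ s s s λ' M →
  ∀ {A B} k → augmentedMonomial A k ≡ augmentedMonomial B k →
  moment (substRows M A) k ≡ moment (substRows M B) k
moment-substRows-agree {λ' = λ'} {M} oa {A} {B} k agree = begin
  moment (substRows M A) k         ≡⟨ moment-substRows oa A k ⟩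
  λ' · 1ℚ * augmentedMonomial A k  ≡⟨ cong (λ' · 1ℚ *_) agree ⟩
  λ' · 1ℚ * augmentedMonomial B k  ≡⟨ moment-substRows oa B k ⟨
  moment (substRows M B) k         ∎

avoid-two : ∀ {n} (x y : Fin (3 + n)) → ∃ λ c → c ≢ x × c ≢ y
avoid-two zero          zero          = suc zero , (λ ()) , (λ ())
avoid-two zero          (suc zero)    = suc (suc zero) , (λ ()) , (λ ())
avoid-two zero          (suc (suc _)) = suc zero , (λ ()) , (λ ())
avoid-two (suc zero)    zero          = suc (suc zero) , (λ ()) , (λ ())
avoid-two (suc (suc _)) zero          = suc zero , (λ ()) , (λ ())
avoid-two (suc _)       (suc _)       = zero , (λ ()) , (λ ())

punchIn-strictlyIncreasing : ∀ {n} (c : Fin (ℕ.suc n)) → StrictlyIncreasing (Fin.punchIn c)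
punchIn-strictlyIncreasing c x y x<y = ℕₚ.≰⇒> (ℕₚ.<⇒≱ x<y ∘ Finₚ.punchIn-cancel-≤ c y x)

module _ {ℓ r s λ'} {M : Fin ℓ → Fin r → Fin s} (oa : IsOAI ℓ r s s λ' M) where

  -- Two of the first s + 1 columns lie among the s columns left after dropping a third one,
  -- and every row is injective on those.
  row-prefix-injective : 2 ≤ s → (s<r : s ℕ.< r) (i : Fin ℓ) →
                         Injective (λ x → M i (Fin.inject≤ x s<r))
  row-prefix-injective (ℕ.s≤s (ℕ.s≤s _)) s<r i x y Mix≡Miy = Finₚ.punchOut-injective c≢x c≢y
    (IsOAI.onlyDistinct oa columns columns-increasing i _ _ (begin
      row (Fin.punchIn c (Fin.punchOut c≢x))  ≡⟨ cong row (Finₚ.punchIn-punchOut c≢x) ⟩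
      row x                                   ≡⟨ Mix≡Miy ⟩
      row y                                   ≡⟨ cong row (Finₚ.punchIn-punchOut c≢y) ⟨
      row (Fin.punchIn c (Fin.punchOut c≢y))  ∎))
    where
    row : Fin (ℕ.suc s) → Fin s
    row z = M i (Fin.inject≤ z s<r)
    c : Fin (ℕ.suc s)
    c = proj₁ (avoid-two x y)
    c≢x : c ≢ x
    c≢x = proj₁ (proj₂ (avoid-two x y))
    c≢y : c ≢ y
    c≢y = proj₂ (proj₂ (avoid-two x y))
    columns : Fin s → Fin r
    columns z = Fin.inject≤ (Fin.punchIn c z) s<r
    columns-increasing : StrictlyIncreasing columns
    columns-increasing a b a<b = subst₂ ℕ._<_
      (sym (Finₚ.toℕ-inject≤ _ s<r)) (sym (Finₚ.toℕ-inject≤ _ s<r)) (punchIn-strictlyIncreasing c a b a<b)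

  columns≡symbols : 2 ≤ s → r ≡ s
  columns≡symbols 2≤s = ℕₚ.≤-antisym
    (ℕₚ.≮⇒≥ (λ s<r → ℕₚ.n≮n s (Finₚ.injective⇒≤ (row-prefix-injective 2≤s s<r row₀ _ _))))
    (IsOAI.t≤r oa)
    where
    row₀ : Fin ℓ
    row₀ = Fin.fromℕ< (IsOAI.ℓ-pos oa)

plusMinus-↑ˡ : ∀ {ℓ r} (X : Fin ℓ → Fin r → ℚ) i j → plusMinus X (i ↑ˡ ℓ) j ≡ X i j
plusMinus-↑ˡ {ℓ} X i j rewrite Finₚ.splitAt-↑ˡ ℓ i ℓ = refl

plusMinus-↑ʳ : ∀ {ℓ r} (X : Fin ℓ → Fin r → ℚ) i j → plusMinus X (ℓ ↑ʳ i) j ≡ - X i j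
plusMinus-↑ʳ {ℓ} X i j rewrite Finₚ.splitAt-↑ʳ ℓ ℓ i = refl

moment-plusMinus : ∀ {ℓ r} (X : Fin ℓ → Fin r → ℚ) k →
                   moment (plusMinus X) k ≡ moment X k ℚ.+ (- 1ℚ) ^ ℕΣ k * moment X k
moment-plusMinus {ℓ} X k = begin
  moment (plusMinus X) k
    ≡⟨ ∑-↑ ℓ (λ i → ℚΠ (λ j → plusMinus X i j ^ k j)) ⟩
  ∑[ i < ℓ ] ℚΠ (λ j → plusMinus X (i ↑ˡ ℓ) j ^ k j)
    ℚ.+ ∑[ i < ℓ ] ℚΠ (λ j → plusMinus X (ℓ ↑ʳ i) j ^ k j)
    ≡⟨ cong₂ ℚ._+_ (sum-cong-≗ (λ i → ℚΠ-cong (λ j → cong (_^ k j) (plusMinus-↑ˡ X i j))))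
                   (sum-cong-≗ (λ i → trans (ℚΠ-cong (λ j → cong (_^ k j) (plusMinus-↑ʳ X i j)))
                                            (ℚΠ-neg (X i) k))) ⟩
  moment X k ℚ.+ ∑[ i < ℓ ] ((- 1ℚ) ^ ℕΣ k * ℚΠ (λ j → X i j ^ k j))
    ≡⟨ cong (moment X k ℚ.+_) (*-distribˡ-sum ((- 1ℚ) ^ ℕΣ k) (λ i → ℚΠ (λ j → X i j ^ k j))) ⟨
  moment X k ℚ.+ (- 1ℚ) ^ ℕΣ k * moment X k ∎

-1^-cases : ∀ n → (- 1ℚ) ^ n ≡ 1ℚ ⊎ (- 1ℚ) ^ n ≡ - 1ℚ
-1^-cases ℕ.zero = inj₁ refl
-1^-cases (ℕ.suc n) with -1^-cases n
... | inj₁ σ≡1  = inj₂ (cong (- 1ℚ *_) σ≡1)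
... | inj₂ σ≡-1 = inj₁ (cong (- 1ℚ *_) σ≡-1)

moment-plusMinus-agree : ∀ {ℓ r} (X Y : Fin ℓ → Fin r → ℚ) k →
  ((- 1ℚ) ^ ℕΣ k ≡ 1ℚ → moment X k ≡ moment Y k) → moment (plusMinus X) k ≡ moment (plusMinus Y) k
moment-plusMinus-agree X Y k even-agree with -1^-cases (ℕΣ k)
... | inj₁ σ≡1  = begin
  moment (plusMinus X) k
    ≡⟨ moment-plusMinus X k ⟩
  moment X k ℚ.+ (- 1ℚ) ^ ℕΣ k * moment X k
    ≡⟨ cong (λ x → x ℚ.+ (- 1ℚ) ^ ℕΣ k * x) (even-agree σ≡1) ⟩
  moment Y k ℚ.+ (- 1ℚ) ^ ℕΣ k * moment Y k
    ≡⟨ moment-plusMinus Y k ⟨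
  moment (plusMinus Y) k ∎
... | inj₂ σ≡-1 = trans (cancels X) (sym (cancels Y))
  where
  cancels : ∀ Z → moment (plusMinus Z) k ≡ 0ℚ
  cancels Z = begin
    moment (plusMinus Z) k
      ≡⟨ moment-plusMinus Z k ⟩
    moment Z k ℚ.+ (- 1ℚ) ^ ℕΣ k * moment Z k
      ≡⟨ cong (λ σ → moment Z k ℚ.+ σ * moment Z k) σ≡-1 ⟩
    moment Z k ℚ.+ - 1ℚ * moment Z k
      ≡⟨ cong (moment Z k ℚ.+_) (-1*x≈-x (moment Z k)) ⟩
    moment Z k ℚ.+ - moment Z k
      ≡⟨ ℚₚ.+-inverseʳ (moment Z k) ⟩
    0ℚ ∎

-1^[q*2]≡1 : ∀ q → (- 1ℚ) ^ (q ℕ.* 2) ≡ 1ℚ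
-1^[q*2]≡1 ℕ.zero    = refl
-1^[q*2]≡1 (ℕ.suc q) = cong (λ σ → - 1ℚ * (- 1ℚ * σ)) (-1^[q*2]≡1 q)

-1^odd≢1 : ∀ {n} → 2 ∣ n → (- 1ℚ) ^ ℕ.suc n ≢ 1ℚ
-1^odd≢1 (divides q refl) σ≡1 with trans (sym σ≡1) (cong (- 1ℚ *_) (-1^[q*2]≡1 q))
... | ()

even-weight : ∀ {m w} → 2 ∣ m → w ≤ m + 3 → (- 1ℚ) ^ w ≡ 1ℚ → w ≤ m + 2 × w ≢ m + 1
even-weight {m} {w} 2∣m w≤m+3 σ≡1 = w≤m+2 , w≢m+1
  where
  ≢odd : ∀ {n} → 2 ∣ n → w ≢ ℕ.suc n
  ≢odd 2∣n refl = -1^odd≢1 2∣n σ≡1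
  w≢m+1 : w ≢ m + 1
  w≢m+1 w≡m+1 = ≢odd 2∣m (trans w≡m+1 (ℕₚ.+-comm m 1))
  w≤m+2 : w ≤ m + 2
  w≤m+2 = ℕ.s≤s⁻¹ (ℕₚ.≤∧≢⇒< (subst (w ≤_) (ℕₚ.+-suc m 2) w≤m+3)
                              (≢odd (∣m∣n⇒∣m+n 2∣m (∣-refl {2}))))

module _ {ℓ r s} (M : Fin ℓ → Fin r → Fin s) (A B : Fin s → ℚ) where

  plusMinus-signed : ∀ p i c → ∃ λ σ → ∃ λ a →
                     plusMinus (substRows M (signedAB A B p zero)) i c ≡ signedAB A B p σ a
  plusMinus-signed p i c with Fin.splitAt ℓ i
  ... | inj₁ k = zero , M k c , refl
  ... | inj₂ k = suc zero , M k c , negated p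
    where
    negated : ∀ p → - signedAB A B p zero (M k c) ≡ signedAB A B p (suc zero) (M k c)
    negated zero    = refl
    negated (suc _) = refl

  plusMinus-noCommon : MutuallyDistinct (signedAB A B) → Fin r → ∀ i j →
    ¬ (∀ c → plusMinus (substRows M A) i c ≡ plusMinus (substRows M B) j c)
  plusMinus-noCommon distinct c i j same
    with plusMinus-signed zero i c | plusMinus-signed (suc zero) j c
  ... | σ , a , Xic≡±A | τ , b , Yjc≡±B
    with distinct zero σ a (suc zero) τ b (trans (sym Xic≡±A) (trans (same c) Yjc≡±B))
  ... | () , _

powerSum₁≡0 : ∀ {s} (A : Fin s → ℚ) → ℚΣ A ≡ 0ℚ → powerSum A 1 ≡ 0ℚ
powerSum₁≡0 A ΣA≡0 =
  trans (sum-cong-≗ (λ a → ℚₚ.*-identityʳ (A a))) (trans (sym (ℚΣ≡∑ A)) ΣA≡0)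

powerSums-agree : ∀ {s m} {A B : Fin s → ℚ} → IsPTE 1 s m (λ i _ → A i) (λ i _ → B i) →
  ℚΣ (λ i → A i ^ (m + 2)) ≡ ℚΣ (λ i → B i ^ (m + 2)) →
  ∀ e → e ≤ m + 2 → e ≢ m + 1 → powerSum A e ≡ powerSum B e
powerSums-agree                 pte top ℕ.zero      _     _     = refl
powerSums-agree {s} {m} {A} {B} pte top e@(ℕ.suc _) e≤m+2 e≢m+1 with e ℕₚ.≤? m
... | yes e≤m = begin
  powerSum A e               ≡⟨ sum-cong-≗ (λ a → ℚₚ.*-identityʳ (A a ^ e)) ⟨
  ∑[ i < s ] (A i ^ e * 1ℚ)  ≡⟨ ℚΣ≡∑ (λ i → A i ^ e * 1ℚ) ⟨
  ℚΣ (λ i → A i ^ e * 1ℚ)    ≡⟨ IsPTE.powerSums pte (λ _ → e) (ℕ.s≤s ℕ.z≤n)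
                                  (subst (_≤ m) (sym (ℕₚ.+-identityʳ e)) e≤m) ⟩
  ℚΣ (λ i → B i ^ e * 1ℚ)    ≡⟨ ℚΣ≡∑ (λ i → B i ^ e * 1ℚ) ⟩
  ∑[ i < s ] (B i ^ e * 1ℚ)  ≡⟨ sum-cong-≗ (λ b → ℚₚ.*-identityʳ (B b ^ e)) ⟩
  powerSum B e               ∎
... | no e≰m = begin
  powerSum A e               ≡⟨ cong (powerSum A) e≡m+2 ⟩
  powerSum A (m + 2)         ≡⟨ ℚΣ≡∑ (λ i → A i ^ (m + 2)) ⟨
  ℚΣ (λ i → A i ^ (m + 2))   ≡⟨ top ⟩
  ℚΣ (λ i → B i ^ (m + 2))   ≡⟨ ℚΣ≡∑ (λ i → B i ^ (m + 2)) ⟩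
  powerSum B (m + 2)         ≡⟨ cong (powerSum B) e≡m+2 ⟨
  powerSum B e               ∎
  where
  m+1<e : m + 1 ℕ.< e
  m+1<e = ℕₚ.≤∧≢⇒< (subst (ℕ._≤ e) (ℕₚ.+-comm 1 m) (ℕₚ.≰⇒> e≰m)) (e≢m+1 ∘ sym)
  e≡m+2 : e ≡ m + 2
  e≡m+2 = ℕₚ.≤-antisym e≤m+2 (subst (ℕ._≤ e) (sym (ℕₚ.+-suc m 1)) m+1<e)

theorem5p5 : (m ℓ r s λ' : ℕ) → 2 ≤ m → 2 ∣ m →
    (M : Fin ℓ → Fin r → Fin s) → IsOAI ℓ r s s λ' M → m + 1 ≤ s →
    (A B : Fin s → ℚ) → MutuallyDistinct (signedAB A B) →
    IsPTE 1 s m (λ i _ → A i) (λ i _ → B i) →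
    ℚΣ (λ i → A i ^ (m + 2)) ≡ ℚΣ (λ i → B i ^ (m + 2)) →
    ℚΣ A ≡ 0ℚ → ℚΣ B ≡ 0ℚ →
    IsPTE r (ℓ + ℓ) (m + 3) (plusMinus (substRows M A)) (plusMinus (substRows M B))
theorem5p5 m ℓ r s λ' 2≤m 2∣m M oa m+1≤s A B distinct pte top ΣA≡0 ΣB≡0
  with columns≡symbols oa (ℕₚ.≤-trans 2≤m (ℕₚ.≤-trans (ℕₚ.m≤m+n m 1) m+1≤s))
... | refl = record
  { noCommon  = plusMinus-noCommon M A B distinct (Fin.fromℕ< (IsOAI.r-pos oa))
  ; powerSums = λ k _ ∣k∣≤m+3 → begin
      ℚΣ (λ i → ℚΠ (λ j → X i j ^ k j))  ≡⟨ ℚΣ≡∑ (λ i → ℚΠ (λ j → X i j ^ k j)) ⟩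
      moment X k                          ≡⟨ moment-plusMinus-agree (substRows M A) (substRows M B) k
                                               (moment-substRows-agree oa {A} {B} k ∘ uncurry (agree k)
                                                ∘ even-weight 2∣m ∣k∣≤m+3) ⟩
      moment Y k                          ≡⟨ ℚΣ≡∑ (λ i → ℚΠ (λ j → Y i j ^ k j)) ⟨
      ℚΣ (λ i → ℚΠ (λ j → Y i j ^ k j))  ∎
  }
  where
  X Y : Fin (ℓ + ℓ) → Fin s → ℚ
  X = plusMinus (substRows M A)
  Y = plusMinus (substRows M B)
  agree : ∀ k → ℕΣ k ≤ m + 2 → ℕΣ k ≢ m + 1 → augmentedMonomial A k ≡ augmentedMonomial B k
  agree = augmentedMonomial-agree A B m (powerSums-agree pte top) (powerSum₁≡0 A ΣA≡0) (powerSum₁≡0 B ΣB≡0)
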